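{- Let $n\ge 4$. If $S$ is a determining set of the folded hypercube $FQ_n$ containing $\mathbf{0}$, then its characteristic matrix $X(S)$ has a zero row and distinct, nonzero columns.
   Context: $FQ_n$ has vertex set $\mathbb{Z}_2^n$, two vertices being adjacent iff they differ in exactly one position or in all $n$ positions. A determining set is a vertex set such that the only automorphism fixing each of its vertices is the identity. For an ordered set $S=\{\mathbf{v}_1,\dots,\mathbf{v}_r\}$ of binary strings of length $n$, the characteristic matrix $X(S)$ is the $r\times n$ binary matrix whose $(i,j)$ entry is the $j$-th position of $\mathbf{v}_i$. -}

module Defs where

open import Data.Nat using (ℕ; zero; suc)
open import Data.Bool using (Bool; true; false; _xor_)
open import Data.Vec using (Vec; []; _∷_; lookup; replicate)
open import Data.Fin using (Fin)
open import Data.List using (List; map; length)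
open import Data.List.Membership.Propositional using (_∈_)
open import Data.Sum using (_⊎_)
open import Relation.Binary.PropositionalEquality using (_≡_)
open import Function.Bundles using (_⇔_)

Word : ℕ → Set
Word n = Vec Bool n

dist : ∀ {n} → Word n → Word n → ℕ
dist [] [] = 0
dist (false ∷ u) (false ∷ v) = dist u v
dist (true ∷ u) (true ∷ v) = dist u v
dist (false ∷ u) (true ∷ v) = suc (dist u v)
dist (true ∷ u) (false ∷ v) = suc (dist u v)

Adj : (n : ℕ) → Word n → Word n → Set
Adj n u v = (dist u v ≡ 1) ⊎ (dist u v ≡ n)

record Aut (n : ℕ) : Set where
  field
    to       : Word n → Word n
    from     : Word n → Word n
    to-from  : ∀ x → to (from x) ≡ x
    from-to  : ∀ x → from (to x) ≡ x
    adj      : ∀ u v → Adj n u v ⇔ Adj n (to u) (to v)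

Determining : (n : ℕ) → List (Word n) → Set
Determining n S = (σ : Aut n) → (∀ v → v ∈ S → Aut.to σ v ≡ v) → ∀ x → Aut.to σ x ≡ x

zeroWord : ∀ n → Word n
zeroWord n = replicate n false

-- characteristic matrix X(S): row i is the i-th element of S;
-- column j is the list of j-th entries of the elements of S
column : ∀ {n} → List (Word n) → Fin n → List Bool
column S j = map (λ v → lookup v j) S

zeroColumn : ∀ {n} → List (Word n) → List Bool
zeroColumn S = Data.List.replicate (length S) false

{-# OPTIONS --safe #-}
-- Two families of automorphisms of FQ_n do the work. Permuting coordinates preserves Hamming
-- distance. The half flip at j complements every coordinate except the j-th, but only on the
-- half x_j = 1: it is an isometry on each half, and across the halves it turns distance d into
-- n + 1 − d, so it exchanges the two kinds of edges of FQ_n. If columns j and k of X(S) agree,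
-- the transposition of j and k fixes S; if column j is zero, the half flip at j fixes S. Both
-- move the unit vector e_j, so neither can happen when S is determining, while the zero row is
-- just 0 ∈ S.
module Submission where

open import Defs
open import Data.Nat using (ℕ; _≥_; suc; _+_; s≤s)
open import Data.Nat.Properties using (+-comm; +-suc; +-cancelʳ-≡; +-0-commutativeMonoid)
open import Data.Bool using (Bool; false; true; not; _xor_; if_then_else_)
open import Data.Bool.Properties using (not-¬; not-involutive) renaming (_≟_ to _≟ᵇ_)
open import Data.Fin using (Fin) renaming (zero to fzero; suc to fsuc)
open import Data.Fin.Properties using (_≟_; punchInᵢ≢i)
open import Data.Fin.Permutation using (Permutation′; _⟨$⟩ʳ_; inverseˡ; flip; transpose)
import Data.Fin.Permutation.Components as PC
open import Data.Vec using ([]; _∷_; replicate; tabulate; _[_]≔_) renaming (lookup to vlookup; map to vmap)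
open import Data.Vec.Properties using (lookup-map; lookup∘tabulate; tabulate∘lookup; tabulate-cong; lookup∘update; lookup∘update′; lookup-replicate)
open import Data.List using (List; lookup; length; map; []; _∷_)
open import Data.List.Properties using (∷-injective)
open import Data.List.Membership.Propositional using (_∈_)
open import Data.List.Relation.Unary.Any using (here; there; index)
open import Data.List.Relation.Unary.Any.Properties using (lookup-index)
open import Data.List.Relation.Unary.Unique.Propositional using (Unique)
open import Data.Product using (_×_; ∃; _,_; proj₁; proj₂)
open import Data.Sum using (_⊎_; inj₁; inj₂)
open import Function using (const; _∘_)
open import Function.Bundles using (mk⇔)
open import Relation.Nullary using (yes; no; contradiction)
open import Relation.Binary.PropositionalEquality using (_≡_; _≢_; refl; sym; trans; cong; cong₂; subst; subst₂; module ≡-Reasoning)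
open import Algebra.Properties.CommutativeMonoid.Sum +-0-commutativeMonoid using (sum; sum-permute; sum-cong-≗)

map-≡⇒≡-on : ∀ {A B : Set} {f g : A → B} {xs : List A} {x : A} →
             map f xs ≡ map g xs → x ∈ xs → f x ≡ g x
map-≡⇒≡-on {xs = _ ∷ _} eq (here refl)  = proj₁ (∷-injective eq)
map-≡⇒≡-on {xs = _ ∷ _} eq (there x∈xs) = map-≡⇒≡-on (proj₂ (∷-injective eq)) x∈xs

map-const : ∀ {A B : Set} (b : B) (xs : List A) → map (const b) xs ≡ Data.List.replicate (length xs) b
map-const b []       = refl
map-const b (_ ∷ xs) = cong (b ∷_) (map-const b xs)

column-≡⇒lookup-≡ : ∀ {n} {S : List (Word n)} {j k : Fin n} {v : Word n} →
                    column S j ≡ column S k → v ∈ S → vlookup v j ≡ vlookup v k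
column-≡⇒lookup-≡ = map-≡⇒≡-on

column-zero⇒lookup-false : ∀ {n} {S : List (Word n)} {j : Fin n} {v : Word n} →
                           column S j ≡ zeroColumn S → v ∈ S → vlookup v j ≡ false
column-zero⇒lookup-false {S = S} eq = map-≡⇒≡-on (trans eq (sym (map-const false S)))

mismatch : Bool → Bool → ℕ
mismatch a b = if a xor b then 1 else 0

dist≡sum-mismatch : ∀ {n} (u v : Word n) → dist u v ≡ sum (λ i → mismatch (vlookup u i) (vlookup v i))
dist≡sum-mismatch []          []          = refl
dist≡sum-mismatch (false ∷ u) (false ∷ v) = dist≡sum-mismatch u v
dist≡sum-mismatch (false ∷ u) (true  ∷ v) = cong suc (dist≡sum-mismatch u v)
dist≡sum-mismatch (true  ∷ u) (false ∷ v) = cong suc (dist≡sum-mismatch u v)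
dist≡sum-mismatch (true  ∷ u) (true  ∷ v) = dist≡sum-mismatch u v

dist-sym : ∀ {n} (u v : Word n) → dist u v ≡ dist v u
dist-sym []          []          = refl
dist-sym (false ∷ u) (false ∷ v) = dist-sym u v
dist-sym (false ∷ u) (true  ∷ v) = cong suc (dist-sym u v)
dist-sym (true  ∷ u) (false ∷ v) = cong suc (dist-sym u v)
dist-sym (true  ∷ u) (true  ∷ v) = dist-sym u v

complement : ∀ {n} → Word n → Word n
complement = vmap not

dist-complement : ∀ {n} (u v : Word n) → dist (complement u) (complement v) ≡ dist u v
dist-complement []          []          = refl
dist-complement (false ∷ u) (false ∷ v) = dist-complement u v
dist-complement (false ∷ u) (true  ∷ v) = cong suc (dist-complement u v)
dist-complement (true  ∷ u) (false ∷ v) = cong suc (dist-complement u v)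
dist-complement (true  ∷ u) (true  ∷ v) = dist-complement u v

dist-complementʳ+dist : ∀ {n} (u v : Word n) → dist u (complement v) + dist u v ≡ n
dist-complementʳ+dist []          []          = refl
dist-complementʳ+dist (false ∷ u) (false ∷ v) = cong suc (dist-complementʳ+dist u v)
dist-complementʳ+dist (true  ∷ u) (true  ∷ v) = cong suc (dist-complementʳ+dist u v)
dist-complementʳ+dist (false ∷ u) (true  ∷ v) = trans (+-suc _ _) (cong suc (dist-complementʳ+dist u v))
dist-complementʳ+dist (true  ∷ u) (false ∷ v) = trans (+-suc _ _) (cong suc (dist-complementʳ+dist u v))

PreservesAdj : (n : ℕ) → (Word n → Word n) → Set
PreservesAdj n f = ∀ u v → Adj n u v → Adj n (f u) (f v)

mkAut : ∀ {n} (f g : Word n → Word n) → (∀ x → f (g x) ≡ x) → (∀ x → g (f x) ≡ x) →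
        PreservesAdj n f → PreservesAdj n g → Aut n
mkAut {n} f g f∘g g∘f f-adj g-adj = record
  { to      = f
  ; from    = g
  ; to-from = f∘g
  ; from-to = g∘f
  ; adj     = λ u v → mk⇔ (f-adj u v) (subst₂ (Adj n) (g∘f u) (g∘f v) ∘ g-adj (f u) (f v))
  }

dist≡⇒Adj : ∀ {n} {u v u′ v′ : Word n} → dist u′ v′ ≡ dist u v → Adj n u v → Adj n u′ v′
dist≡⇒Adj {n} eq = subst (λ d → (d ≡ 1) ⊎ (d ≡ n)) (sym eq)

isometry⇒PreservesAdj : ∀ {n} (f : Word n → Word n) →
                        (∀ u v → dist (f u) (f v) ≡ dist u v) → PreservesAdj n f
isometry⇒PreservesAdj f f-iso u v = dist≡⇒Adj {u = u} {v} {f u} {f v} (f-iso u v)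

dist+dist≡suc⇒Adj : ∀ {n} {u v u′ v′ : Word n} →
                    dist u′ v′ + dist u v ≡ suc n → Adj n u v → Adj n u′ v′
dist+dist≡suc⇒Adj {n} {u′ = u′} {v′} eq (inj₁ d≡1) =
  inj₂ (+-cancelʳ-≡ 1 (dist u′ v′) n (trans (subst (λ d → dist u′ v′ + d ≡ suc n) d≡1 eq) (+-comm 1 n)))
dist+dist≡suc⇒Adj {n} {u′ = u′} {v′} eq (inj₂ d≡n) =
  inj₁ (+-cancelʳ-≡ n (dist u′ v′) 1 (subst (λ d → dist u′ v′ + d ≡ suc n) d≡n eq))

permuteCoords : ∀ {n} → Permutation′ n → Word n → Word n
permuteCoords π x = tabulate (λ i → vlookup x (π ⟨$⟩ʳ i))

lookup-permuteCoords : ∀ {n} (π : Permutation′ n) (x : Word n) (i : Fin n) →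
                       vlookup (permuteCoords π x) i ≡ vlookup x (π ⟨$⟩ʳ i)
lookup-permuteCoords π x = lookup∘tabulate (λ i → vlookup x (π ⟨$⟩ʳ i))

permuteCoords-flip : ∀ {n} (π : Permutation′ n) (x : Word n) → permuteCoords π (permuteCoords (flip π) x) ≡ x
permuteCoords-flip π x = trans (tabulate-cong λ i →
    trans (lookup∘tabulate _ (π ⟨$⟩ʳ i)) (cong (vlookup x) (inverseˡ π)))
  (tabulate∘lookup x)

dist-permuteCoords : ∀ {n} (π : Permutation′ n) (u v : Word n) →
                     dist (permuteCoords π u) (permuteCoords π v) ≡ dist u v
dist-permuteCoords π u v = begin
  dist (permuteCoords π u) (permuteCoords π v)                      ≡⟨ dist≡sum-mismatch (permuteCoords π u) (permuteCoords π v) ⟩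
  sum (λ i → mismatch (vlookup (permuteCoords π u) i) (vlookup (permuteCoords π v) i))
    ≡⟨ sum-cong-≗ (λ i → cong₂ mismatch (lookup-permuteCoords π u i) (lookup-permuteCoords π v i)) ⟩
  sum (λ i → mismatch (vlookup u (π ⟨$⟩ʳ i)) (vlookup v (π ⟨$⟩ʳ i))) ≡⟨ sym (sum-permute (λ i → mismatch (vlookup u i) (vlookup v i)) π) ⟩
  sum (λ i → mismatch (vlookup u i) (vlookup v i))                  ≡⟨ sym (dist≡sum-mismatch u v) ⟩
  dist u v                                                          ∎
  where open ≡-Reasoning

permutationAut : ∀ {n} → Permutation′ n → Aut n
permutationAut π = mkAut (permuteCoords π) (permuteCoords (flip π))
  (permuteCoords-flip π) (permuteCoords-flip (flip π))
  (isometry⇒PreservesAdj (permuteCoords π) (dist-permuteCoords π))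
  (isometry⇒PreservesAdj (permuteCoords (flip π)) (dist-permuteCoords (flip π)))

transpose-preserves : ∀ {A : Set} {n} (f : Fin n → A) {j k : Fin n} →
                      f j ≡ f k → ∀ i → f (PC.transpose j k i) ≡ f i
transpose-preserves f {j} {k} fj≡fk i with i ≟ j
... | yes refl = sym fj≡fk
... | no _ with i ≟ k
...   | yes refl = fj≡fk
...   | no _     = refl

transpose-matchˡ : ∀ {n} (j k : Fin n) → PC.transpose j k j ≡ k
transpose-matchˡ j k with j ≟ j
... | yes _   = refl
... | no j≢j = contradiction refl j≢j

permuteCoords-transpose-fixes : ∀ {n} {j k : Fin n} {x : Word n} →
                                vlookup x j ≡ vlookup x k → permuteCoords (transpose j k) x ≡ x
permuteCoords-transpose-fixes {x = x} xj≡xk =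
  trans (tabulate-cong (transpose-preserves (vlookup x) xj≡xk)) (tabulate∘lookup x)

permuteCoords-transpose-moves : ∀ {n} {j k : Fin n} {x : Word n} →
                                vlookup x j ≢ vlookup x k → permuteCoords (transpose j k) x ≢ x
permuteCoords-transpose-moves {j = j} {k} {x} xj≢xk fixed = xj≢xk (sym (begin
  vlookup x k                                       ≡⟨ cong (vlookup x) (sym (transpose-matchˡ j k)) ⟩
  vlookup x (PC.transpose j k j)                    ≡⟨ sym (lookup-permuteCoords (transpose j k) x j) ⟩
  vlookup (permuteCoords (transpose j k) x) j       ≡⟨ cong (λ y → vlookup y j) fixed ⟩
  vlookup x j                                       ∎))
  where open ≡-Reasoning

complementExcept : ∀ {n} → Fin n → Word n → Word n
complementExcept fzero    (b ∷ x) = b ∷ complement x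
complementExcept (fsuc j) (b ∷ x) = not b ∷ complementExcept j x

complement-involutive : ∀ {n} (x : Word n) → complement (complement x) ≡ x
complement-involutive []      = refl
complement-involutive (b ∷ x) = cong₂ _∷_ (not-involutive b) (complement-involutive x)

complementExcept-involutive : ∀ {n} (j : Fin n) (x : Word n) → complementExcept j (complementExcept j x) ≡ x
complementExcept-involutive fzero    (b ∷ x) = cong (b ∷_) (complement-involutive x)
complementExcept-involutive (fsuc j) (b ∷ x) = cong₂ _∷_ (not-involutive b) (complementExcept-involutive j x)

lookup-complementExcept-self : ∀ {n} (j : Fin n) (x : Word n) → vlookup (complementExcept j x) j ≡ vlookup x j
lookup-complementExcept-self fzero    (b ∷ x) = refl
lookup-complementExcept-self (fsuc j) (b ∷ x) = lookup-complementExcept-self j x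

lookup-complementExcept-other : ∀ {n} {j k : Fin n} (x : Word n) → k ≢ j →
                                vlookup (complementExcept j x) k ≡ not (vlookup x k)
lookup-complementExcept-other {j = fzero}  {fzero}  x       k≢j = contradiction refl k≢j
lookup-complementExcept-other {j = fzero}  {fsuc k} (b ∷ x) _   = lookup-map k not x
lookup-complementExcept-other {j = fsuc j} {fzero}  (b ∷ x) _   = refl
lookup-complementExcept-other {j = fsuc j} {fsuc k} (b ∷ x) k≢j =
  lookup-complementExcept-other x (k≢j ∘ cong fsuc)

dist-∷-congʳ : ∀ {n} (a b : Bool) {u v u′ v′ : Word n} → dist u v ≡ dist u′ v′ → dist (a ∷ u) (b ∷ v) ≡ dist (a ∷ u′) (b ∷ v′)
dist-∷-congʳ false false eq = eq
dist-∷-congʳ false true  eq = cong suc eq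
dist-∷-congʳ true  false eq = cong suc eq
dist-∷-congʳ true  true  eq = eq

dist-complementExcept : ∀ {n} (j : Fin n) (u v : Word n) →
                        dist (complementExcept j u) (complementExcept j v) ≡ dist u v
dist-complementExcept fzero    (a ∷ u) (b ∷ v) = dist-∷-congʳ a b (dist-complement u v)
dist-complementExcept (fsuc j) (false ∷ u) (false ∷ v) = dist-complementExcept j u v
dist-complementExcept (fsuc j) (false ∷ u) (true  ∷ v) = cong suc (dist-complementExcept j u v)
dist-complementExcept (fsuc j) (true  ∷ u) (false ∷ v) = cong suc (dist-complementExcept j u v)
dist-complementExcept (fsuc j) (true  ∷ u) (true  ∷ v) = dist-complementExcept j u v

dist-complementExceptʳ+dist : ∀ {n} (j : Fin n) (u v : Word n) → vlookup u j ≢ vlookup v j →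
                              dist u (complementExcept j v) + dist u v ≡ suc n
dist-complementExceptʳ+dist fzero (false ∷ u) (false ∷ v) u≢v = contradiction refl u≢v
dist-complementExceptʳ+dist fzero (true  ∷ u) (true  ∷ v) u≢v = contradiction refl u≢v
dist-complementExceptʳ+dist fzero (false ∷ u) (true  ∷ v) _ =
  cong suc (trans (+-suc _ _) (cong suc (dist-complementʳ+dist u v)))
dist-complementExceptʳ+dist fzero (true  ∷ u) (false ∷ v) _ =
  cong suc (trans (+-suc _ _) (cong suc (dist-complementʳ+dist u v)))
dist-complementExceptʳ+dist (fsuc j) (false ∷ u) (false ∷ v) u≢v = cong suc (dist-complementExceptʳ+dist j u v u≢v)
dist-complementExceptʳ+dist (fsuc j) (true  ∷ u) (true  ∷ v) u≢v = cong suc (dist-complementExceptʳ+dist j u v u≢v)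
dist-complementExceptʳ+dist (fsuc j) (false ∷ u) (true  ∷ v) u≢v =
  trans (+-suc _ _) (cong suc (dist-complementExceptʳ+dist j u v u≢v))
dist-complementExceptʳ+dist (fsuc j) (true  ∷ u) (false ∷ v) u≢v =
  trans (+-suc _ _) (cong suc (dist-complementExceptʳ+dist j u v u≢v))

halfFlip : ∀ {n} → Fin n → Word n → Word n
halfFlip j x = if vlookup x j then complementExcept j x else x

halfFlip-false : ∀ {n} {j : Fin n} {x : Word n} → vlookup x j ≡ false → halfFlip j x ≡ x
halfFlip-false {j = j} {x} xj≡false = cong (λ b → if b then complementExcept j x else x) xj≡false

halfFlip-true : ∀ {n} {j : Fin n} {x : Word n} → vlookup x j ≡ true → halfFlip j x ≡ complementExcept j x
halfFlip-true {j = j} {x} xj≡true = cong (λ b → if b then complementExcept j x else x) xj≡true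

halfFlip-involutive : ∀ {n} (j : Fin n) (x : Word n) → halfFlip j (halfFlip j x) ≡ x
halfFlip-involutive j x with vlookup x j in xj
... | false = halfFlip-false xj
... | true  = trans (halfFlip-true (trans (lookup-complementExcept-self j x) xj)) (complementExcept-involutive j x)

dist-halfFlip-same : ∀ {n} (j : Fin n) (u v : Word n) → vlookup u j ≡ vlookup v j →
                     dist (halfFlip j u) (halfFlip j v) ≡ dist u v
dist-halfFlip-same j u v same with vlookup u j in uj | vlookup v j in vj
... | false | false = refl
... | true  | true  = dist-complementExcept j u v
... | false | true  = contradiction same λ ()
... | true  | false = contradiction same λ ()

dist-halfFlip-apart : ∀ {n} (j : Fin n) (u v : Word n) → vlookup u j ≢ vlookup v j →
                      dist (halfFlip j u) (halfFlip j v) + dist u v ≡ suc n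
dist-halfFlip-apart j u v apart with vlookup u j in uj | vlookup v j in vj
... | false | false = contradiction refl apart
... | true  | true  = contradiction refl apart
... | false | true  = dist-complementExceptʳ+dist j u v (λ eq → apart (trans (sym uj) (trans eq vj)))
... | true  | false = trans (cong₂ _+_ (dist-sym (complementExcept j u) v) (dist-sym u v))
                            (dist-complementExceptʳ+dist j v u (λ eq → apart (trans (sym uj) (trans (sym eq) vj))))

halfFlip-preservesAdj : ∀ {n} (j : Fin n) → PreservesAdj n (halfFlip j)
halfFlip-preservesAdj j u v with vlookup u j ≟ᵇ vlookup v j
... | yes same  = dist≡⇒Adj {u = u} {v} {halfFlip j u} {halfFlip j v} (dist-halfFlip-same j u v same)
... | no  apart = dist+dist≡suc⇒Adj {u = u} {v} {halfFlip j u} {halfFlip j v} (dist-halfFlip-apart j u v apart)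

halfFlipAut : ∀ {n} → Fin n → Aut n
halfFlipAut j = mkAut (halfFlip j) (halfFlip j) (halfFlip-involutive j) (halfFlip-involutive j)
  (halfFlip-preservesAdj j) (halfFlip-preservesAdj j)

halfFlip-moves : ∀ {n} {j k : Fin n} {x : Word n} → k ≢ j → vlookup x j ≡ true → halfFlip j x ≢ x
halfFlip-moves {j = j} {k} {x} k≢j xj≡true fixed = not-¬ refl (begin
  vlookup x k                                      ≡⟨ cong (λ y → vlookup y k) (sym fixed) ⟩
  vlookup (halfFlip j x) k                         ≡⟨ cong (λ y → vlookup y k) (halfFlip-true {j = j} {x} xj≡true) ⟩
  vlookup (complementExcept j x) k                 ≡⟨ lookup-complementExcept-other x k≢j ⟩
  not (vlookup x k)                                ∎)
  where open ≡-Reasoning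

unitWord : ∀ {n} → Fin n → Word n
unitWord j = replicate _ false [ j ]≔ true

lookup-unitWord-self : ∀ {n} (j : Fin n) → vlookup (unitWord j) j ≡ true
lookup-unitWord-self j = lookup∘update j (replicate _ false) true

lookup-unitWord-other : ∀ {n} {j k : Fin n} → k ≢ j → vlookup (unitWord j) k ≡ false
lookup-unitWord-other {k = k} k≢j = trans (lookup∘update′ k≢j (replicate _ false) true) (lookup-replicate k false)

unitWord-separates : ∀ {n} {j k : Fin n} → k ≢ j → vlookup (unitWord j) j ≢ vlookup (unitWord j) k
unitWord-separates {j = j} k≢j eq with trans (sym (lookup-unitWord-self j)) (trans eq (lookup-unitWord-other k≢j))
... | ()

corollary5p2 : (n : ℕ) → n ≥ 4 → (S : List (Word n)) → Unique S →
    Determining n S → zeroWord n ∈ S →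
    (∃ λ i → lookup S i ≡ replicate n false)
    × (∀ (j k : Fin n) → j ≢ k → column S j ≢ column S k)
    × (∀ (j : Fin n) → column S j ≢ zeroColumn S)
corollary5p2 (suc (suc m)) (s≤s (s≤s _)) S _ determining 0∈S =
  (index 0∈S , sym (lookup-index 0∈S)) , equal-columns-absurd , zero-column-absurd
  where
  equal-columns-absurd : ∀ j k → j ≢ k → column S j ≢ column S k
  equal-columns-absurd j k j≢k cⱼ≡cₖ =
    permuteCoords-transpose-moves
      (unitWord-separates (j≢k ∘ sym))
      (determining (permutationAut (transpose j k))
        (λ v v∈S → permuteCoords-transpose-fixes (column-≡⇒lookup-≡ cⱼ≡cₖ v∈S)) (unitWord j))

  zero-column-absurd : ∀ j → column S j ≢ zeroColumn S
  zero-column-absurd j cⱼ≡0 =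
    halfFlip-moves (punchInᵢ≢i j fzero) (lookup-unitWord-self j)
      (determining (halfFlipAut j)
        (λ v v∈S → halfFlip-false (column-zero⇒lookup-false cⱼ≡0 v∈S)) (unitWord j))
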